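{- Let $k\ge 1$ and $n\ge 1$ be integers. The set $\{\mathrm{RC}_k(\sigma):\sigma\in\mathfrak S_n\}$ of $k$-recoil codes of permutations of size $n$ (which coincides with the set $\{\mathrm{DC}_k(\sigma):\sigma\in\mathfrak S_n\}$ of $k$-descent codes) is exactly the set of words $i_1i_2\cdots i_n$ satisfying $$i_\ell\in[\max(k-\ell+1,1),\,k]\quad\text{for all }\ell,$$ i.e. $k-\ell+1\le i_\ell\le k$ if $\ell\le k$ and $1\le i_\ell\le k$ if $\ell\ge k$. Consequently the number $\mathrm N(k,n)$ of $k$-descent (equivalently, $k$-recoil) classes of $\mathfrak S_n$ is $n!$ if $n\le k$ and $k!\,k^{n-k}$ if $n\ge k$.
   Context: For $\sigma=\sigma_1\cdots\sigma_n\in\mathfrak S_n$, extend $\sigma$ to a bijection of $\mathbb Z$ by $\sigma(j)=j$ for $j\notin[1,n]$. The $k$-descent code of $\sigma$ is the word $\mathrm{DC}_k(\sigma)=d_1d_2\cdots d_n$, where $d_i$ is the rank of $\sigma(i)$ in the increasing ordering of the $k$ numbers $\sigma(i),\sigma(i-1),\dots,\sigma(i-k+1)$; equivalently $d_i=1+\#\{j: i-k+1\le j\le i-1,\ \sigma(j)<\sigma(i)\}$. The $k$-recoil code is $\mathrm{RC}_k(\sigma)=\mathrm{DC}_k(\sigma^{ -1})$. A $k$-descent class (resp. $k$-recoil class) of $\mathfrak S_n$ is a nonempty set of permutations of $\mathfrak S_n$ sharing the same $k$-descent code (resp. $k$-recoil code). -}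

module Defs where

open import Data.Nat using (ℕ; zero; suc; _+_; _*_; _∸_; _^_; _≤_; _<_; _⊔_)
open import Data.Nat.Properties using (_<?_)
open import Relation.Nullary using (yes; no)
open import Data.Integer as ℤ using (ℤ; +_; -[1+_])
open import Data.Fin using (Fin; toℕ; fromℕ<)
open import Data.Fin.Permutation using (Permutation′; _⟨$⟩ʳ_; flip)
open import Data.Vec using (Vec; lookup; tabulate)
open import Data.List using (List; length; filter; map; upTo)
open import Data.List.Membership.Propositional using (_∈_)
open import Data.List.Relation.Unary.Unique.Propositional using (Unique)
open import Data.Product using (Σ; _×_; ∃)
open import Function.Bundles using (_⇔_)
open import Relation.Binary.PropositionalEquality using (_≡_)

-- Extension of σ ∈ 𝔖_n to a bijection of ℤ: positions/values are 1-based,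
-- position i ∈ [1,n] corresponds to Fin index i-1; σ(j) = j outside [1,n].
ext : {n : ℕ} → Permutation′ n → ℤ → ℤ
ext σ (+ zero) = + zero
ext {n} σ (+ suc m) with m <? n
... | yes p = + suc (toℕ (σ ⟨$⟩ʳ fromℕ< p))
... | no _ = + suc m
ext σ -[1+ m ] = -[1+ m ]

-- k-descent code: d_i = 1 + #{ j : i-k+1 ≤ j ≤ i-1, σ(j) < σ(i) },
-- where j = i - t for t = 1, …, k-1.  Entry at Fin index p is d_{p+1}.
DC : ℕ → {n : ℕ} → Permutation′ n → Vec ℕ n
DC k σ = tabulate λ p →
  let i = + suc (toℕ p) in
  suc (length (filter (λ t → ext σ (i ℤ.- + t) ℤ.<? ext σ i) (map suc (upTo (k ∸ 1)))))

RC : ℕ → {n : ℕ} → Permutation′ n → Vec ℕ n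
RC k σ = DC k (flip σ)

ValidWord : ℕ → {n : ℕ} → Vec ℕ n → Set
ValidWord k {n} w = (p : Fin n) →
  let ℓ = suc (toℕ p) in ((suc k ∸ ℓ) ⊔ 1 ≤ lookup w p) × (lookup w p ≤ k)

HasCard : {A : Set} → (A → Set) → ℕ → Set
HasCard {A} P N = Σ (List A) λ L → Unique L × ((x : A) → (x ∈ L) ⇔ P x) × (length L ≡ N)

IsDCode IsRCode : ℕ → (n : ℕ) → Vec ℕ n → Set
IsDCode k n w = ∃ λ (σ : Permutation′ n) → DC k σ ≡ w
IsRCode k n w = ∃ λ (σ : Permutation′ n) → RC k σ ≡ w

-- The k-descent code letter at position ℓ is one plus the number of the k − 1 preceding
-- positions carrying a smaller value.  Since σ fixes every integer ≤ 0, the positions before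
-- the first one always count as smaller, so the letter lies in [max(k − ℓ + 1, 1), k].
-- Conversely every such word is a code, by induction on n: if σ ∈ 𝔖ₙ realises the first n
-- letters, append a last value j ∈ [0, n] and shift the old values ≥ j up by one.  Relative
-- orders among the first n positions are unchanged, hence so are their letters, while the last
-- letter, as a function of j, rises from max(k − n, 1) at j = 0 to k at j = n in steps of at
-- most one, and so takes every admissible value.  As RC_k(σ) = DC_k(σ⁻¹), the recoil codes are
-- the same words.  These words form a product of intervals of sizes min(ℓ, k), ℓ = 1, …, n.

module Submission where

open import Defs
open import Data.Nat using (ℕ; _*_; _∸_; _^_; _≤_; _!)
open import Data.Vec using (Vec)
open import Data.Product using (_×_)
open import Function.Bundles using (_⇔_)

open import Data.Nat using (zero; suc; pred; >-nonZero; _+_; _<_; _⊔_; _⊓_; z≤n; s≤s; s<s⁻¹; _≤?_; _<?_)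
open import Data.Nat.Properties
open import Data.Integer as ℤ using (+_; _⊖_; +<+; -<+)
open import Data.Integer.Properties using ([1+m]⊖[1+n]≡m⊖n; ⊖-≥; ⊖-≤; drop‿+<+)
open import Data.Fin using (Fin; toℕ; fromℕ; fromℕ<; punchIn) renaming (zero to fzero; suc to fsuc)
open import Data.Fin.Properties using (toℕ-injective; toℕ<n; fromℕ<-toℕ; toℕ-fromℕ<; toℕ-fromℕ; punchIn-mono-≤; punchIn-cancel-≤)
open import Data.Fin.Permutation using (Permutation′; _⟨$⟩ʳ_; insert; insert-punchIn; flip)
import Data.Fin.Permutation as Permutation
open import Data.Vec using ([]; _∷_; lookup; tabulate)
open import Data.Vec.Properties using (∷-injective; lookup∘tabulate; tabulate∘lookup; tabulate-cong)
open import Data.List using (List; []; _∷_; length; filter; map; upTo; _++_; [_]; cartesianProductWith)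
open import Data.List.Properties using (filter-++; length-++; upTo-∷ʳ; length-map; length-upTo; length-filter; filter-≐; filter-all; filter-none; filter-accept; filter-reject)
open import Data.List.Membership.Propositional using (_∈_)
open import Data.List.Membership.Propositional.Properties using (∈-map⁺; ∈-map⁻; ∈-upTo⁺; ∈-upTo⁻; ∈-cartesianProductWith⁺; ∈-cartesianProductWith⁻)
open import Data.List.Relation.Binary.Sublist.Propositional using (⊆-refl)
open import Data.List.Relation.Binary.Sublist.Propositional.Properties using (filter⁺; length-mono-≤)
open import Data.List.Relation.Unary.Any using (here)
open import Data.List.Relation.Unary.All as All using (All; [])
open import Data.List.Relation.Unary.Unique.Propositional using (Unique; []; _∷_)
import Data.List.Relation.Unary.Unique.Propositional.Properties as Unique
open import Data.Sum using (_⊎_; inj₁; inj₂)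
open import Data.Product using (∃-syntax; Σ-syntax; _,_; proj₁; proj₂; uncurry)
open import Function using (_∘_)
open import Function.Bundles using (Injection; mk⇔; Equivalence)
open import Function.Properties.Inverse using (↔⇒↣)
open import Function.Construct.Symmetry using (⇔-sym)
open import Function.Construct.Composition using (_⇔-∘_)
open import Level using (0ℓ)
open import Relation.Nullary using (Dec; yes; no; contradiction)
open import Relation.Nullary.Decidable using (_⊎-dec_; _×-dec_)
open import Relation.Unary using (Pred; Decidable; _⊆_; _∪_; _≐_)
open import Relation.Unary.Properties using (_∪?_)
open import Relation.Binary.PropositionalEquality hiding ([_])

module _ {A : Set} {P : Pred A 0ℓ} (P? : Decidable P) where

  length-filter≤1 : (∀ {x y} → P x → P y → x ≡ y) → ∀ {xs} → Unique xs → length (filter P? xs) ≤ 1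
  length-filter≤1 P-unique {[]} _ = z≤n
  length-filter≤1 P-unique {x ∷ xs} (x∉xs ∷ xs!) with P? x
  ... | yes px = s≤s (≤-reflexive (cong length (filter-none P? (All.map (λ x≢y py → x≢y (P-unique px py)) x∉xs))))
  ... | no _ = length-filter≤1 P-unique xs!

  length-filter-++ : ∀ xs ys → length (filter P? (xs ++ ys)) ≡ length (filter P? xs) + length (filter P? ys)
  length-filter-++ xs ys = trans (cong length (filter-++ P? xs ys)) (length-++ (filter P? xs))

  length-filter-map : ∀ {B : Set} (f : B → A) xs → length (filter P? (map f xs)) ≡ length (filter (P? ∘ f) xs)
  length-filter-map f [] = refl
  length-filter-map f (x ∷ xs) with P? (f x)
  ... | yes _ = cong suc (length-filter-map f xs)
  ... | no _ = length-filter-map f xs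

module _ {A : Set} {P Q : Pred A 0ℓ} (P? : Decidable P) (Q? : Decidable Q) where

  length-filter-mono : P ⊆ Q → ∀ xs → length (filter P? xs) ≤ length (filter Q? xs)
  length-filter-mono P⊆Q xs = length-mono-≤ (filter⁺ P? Q? (λ { refl → P⊆Q }) (⊆-refl {x = xs}))

  length-filter-∪ : ∀ xs → length (filter (P? ∪? Q?) xs) ≤ length (filter P? xs) + length (filter Q? xs)
  length-filter-∪ [] = z≤n
  length-filter-∪ (x ∷ xs) with P? x | Q? x
  ... | yes _ | yes _ = s≤s (≤-trans (length-filter-∪ xs) (+-monoʳ-≤ _ (n≤1+n _)))
  ... | yes _ | no _ = s≤s (length-filter-∪ xs)
  ... | no _ | yes _ = ≤-trans (s≤s (length-filter-∪ xs)) (≤-reflexive (sym (+-suc _ _)))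
  ... | no _ | no _ = length-filter-∪ xs

length-filter-≥-upTo : ∀ p m → length (filter (p ≤?_) (upTo m)) ≡ m ∸ p
length-filter-≥-upTo p zero = sym (0∸n≡0 p)
length-filter-≥-upTo p (suc m) = begin
  count (upTo (suc m))           ≡⟨ cong count (upTo-∷ʳ m) ⟨
  count (upTo m ++ [ m ])        ≡⟨ length-filter-++ (p ≤?_) (upTo m) [ m ] ⟩
  count (upTo m) + count [ m ]   ≡⟨ cong (_+ count [ m ]) (length-filter-≥-upTo p m) ⟩
  m ∸ p + count [ m ]            ≡⟨ last-step ⟩
  suc m ∸ p                      ∎
  where
  open ≡-Reasoning
  count : List ℕ → ℕ
  count = length ∘ filter (p ≤?_)
  last-step : m ∸ p + count [ m ] ≡ suc m ∸ p
  last-step with p ≤? m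
  ... | yes p≤m = begin
    m ∸ p + count [ m ]   ≡⟨ cong (λ l → m ∸ p + length l) (filter-accept (p ≤?_) {xs = []} p≤m) ⟩
    m ∸ p + 1             ≡⟨ +-comm (m ∸ p) 1 ⟩
    suc (m ∸ p)           ≡⟨ +-∸-assoc 1 p≤m ⟨
    suc m ∸ p             ∎
  ... | no p≰m = begin
    m ∸ p + count [ m ]   ≡⟨ cong₂ (λ d l → d + length l) (m≤n⇒m∸n≡0 (<⇒≤ m<p)) (filter-reject (p ≤?_) {xs = []} p≰m) ⟩
    0                     ≡⟨ m≤n⇒m∸n≡0 m<p ⟨
    suc m ∸ p             ∎
    where m<p = ≰⇒> p≰m

intermediate-value : (F : ℕ → ℕ) → (∀ r → F (suc r) ≤ suc (F r)) →
  ∀ n {c} → F 0 ≤ c → c ≤ F n → ∃[ r ] r ≤ n × F r ≡ c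
intermediate-value F step zero F0≤c c≤F0 = 0 , z≤n , ≤-antisym F0≤c c≤F0
intermediate-value F step (suc n) {c} F0≤c c≤Fn+1 with c ≤? F n
... | yes c≤Fn = let r , r≤n , Fr≡c = intermediate-value F step n F0≤c c≤Fn in r , m≤n⇒m≤1+n r≤n , Fr≡c
... | no c≰Fn = suc n , ≤-refl , ≤-antisym (≤-trans (step n) (≰⇒> c≰Fn)) c≤Fn+1

extend-agreement : ∀ {n} (g : ℕ → ℕ) (f : ∀ p → p < suc n → ℕ) →
  (∀ p (p<n : p < n) → g p ≡ f p (m<n⇒m<1+n p<n)) → g n ≡ f n ≤-refl →
  ∀ p (p<1+n : p < suc n) → g p ≡ f p p<1+n
extend-agreement g f below at-n p p<1+n with m<1+n⇒m<n∨m≡n p<1+n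
... | inj₁ p<n = trans (below p p<n) (cong (f p) (<-irrelevant _ _))
... | inj₂ refl = trans at-n (cong (f p) (<-irrelevant _ _))

[1+m]∸n≤1+[m∸n] : ∀ m n → suc m ∸ n ≤ suc (m ∸ n)
[1+m]∸n≤1+[m∸n] m zero = ≤-refl
[1+m]∸n≤1+[m∸n] zero (suc n) = ≤-trans (≤-reflexive (0∸n≡0 n)) z≤n
[1+m]∸n≤1+[m∸n] (suc m) (suc n) = [1+m]∸n≤1+[m∸n] m n

∸-suc-< : ∀ {p s} → s < p → p ∸ suc s < p
∸-suc-< s<p = ∸-monoʳ-< (s≤s z≤n) s<p

length-cartesianProductWith : ∀ {A B C : Set} (f : A → B → C) xs ys →
  length (cartesianProductWith f xs ys) ≡ length xs * length ys
length-cartesianProductWith f [] ys = refl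
length-cartesianProductWith f (x ∷ xs) ys = begin
  length (map (f x) ys ++ cartesianProductWith f xs ys)
    ≡⟨ length-++ (map (f x) ys) ⟩
  length (map (f x) ys) + length (cartesianProductWith f xs ys)
    ≡⟨ cong₂ _+_ (length-map (f x) ys) (length-cartesianProductWith f xs ys) ⟩
  length ys + length xs * length ys
    ∎
  where open ≡-Reasoning

-- Words within the bounds

interval : ℕ → ℕ → List ℕ
interval lo hi = map (_+_ lo) (upTo (suc hi ∸ lo))

module _ {lo hi : ℕ} where

  ∈-interval⁺ : ∀ {x} → lo ≤ x → x ≤ hi → x ∈ interval lo hi
  ∈-interval⁺ lo≤x x≤hi = subst (_∈ interval lo hi) (m+[n∸m]≡n lo≤x)
    (∈-map⁺ (_+_ lo) (∈-upTo⁺ (∸-monoˡ-< (s≤s x≤hi) lo≤x)))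

  ∈-interval⁻ : ∀ {x} → x ∈ interval lo hi → lo ≤ x × x ≤ hi
  ∈-interval⁻ x∈ with ∈-map⁻ (_+_ lo) x∈
  ... | y , y∈ , refl = m≤m+n lo y , ≤-pred (begin-strict
    lo + y             <⟨ +-monoʳ-< lo y<1+hi∸lo ⟩
    lo + (suc hi ∸ lo) ≡⟨ m+[n∸m]≡n lo≤1+hi ⟩
    suc hi             ∎)
    where
    open ≤-Reasoning
    y<1+hi∸lo = ∈-upTo⁻ y∈
    lo≤1+hi : lo ≤ suc hi
    lo≤1+hi = <⇒≤ (m∸n≢0⇒n<m (λ eq → n≮0 (subst (y <_) eq y<1+hi∸lo)))

length-interval : ∀ lo hi → length (interval lo hi) ≡ suc hi ∸ lo
length-interval lo hi = trans (length-map (_+_ lo) (upTo (suc hi ∸ lo))) (length-upTo (suc hi ∸ lo))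

interval-unique : ∀ lo hi → Unique (interval lo hi)
interval-unique lo hi = Unique.map⁺ (+-cancelˡ-≡ lo _ _) (Unique.upTo⁺ (suc hi ∸ lo))

ValidEntry : ℕ → ℕ → ℕ → Set
ValidEntry k ℓ x = (k ∸ ℓ) ⊔ 1 ≤ x × x ≤ k

-- ValidFrom k 0 is definitionally ValidWord k.
ValidFrom : ℕ → ℕ → {n : ℕ} → Vec ℕ n → Set
ValidFrom k b w = ∀ p → ValidEntry k (b + toℕ p) (lookup w p)

validWords : ℕ → ℕ → (n : ℕ) → List (Vec ℕ n)
validWords k b zero = [ [] ]
validWords k b (suc n) = cartesianProductWith _∷_ (interval ((k ∸ b) ⊔ 1) k) (validWords k (suc b) n)

module _ (k : ℕ) where

  ∈-validWords⁺ : ∀ b {n} {w : Vec ℕ n} → ValidFrom k b w → w ∈ validWords k b n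
  ∈-validWords⁺ b {w = []} _ = here refl
  ∈-validWords⁺ b {w = x ∷ w} valid = ∈-cartesianProductWith⁺ _∷_
    (uncurry ∈-interval⁺ (subst (λ ℓ → ValidEntry k ℓ x) (+-identityʳ b) (valid fzero)))
    (∈-validWords⁺ (suc b) λ p → subst (λ ℓ → ValidEntry k ℓ (lookup w p)) (+-suc b (toℕ p)) (valid (fsuc p)))

  ∈-validWords⁻ : ∀ b {n} {w : Vec ℕ n} → w ∈ validWords k b n → ValidFrom k b w
  ∈-validWords⁻ b {zero} {[]} _ ()
  ∈-validWords⁻ b {suc n} w∈ with ∈-cartesianProductWith⁻ _∷_ (interval ((k ∸ b) ⊔ 1) k) (validWords k (suc b) n) w∈
  ... | x , w , x∈ , w∈ , refl = λ
    { fzero → subst (λ ℓ → ValidEntry k ℓ x) (sym (+-identityʳ b)) (∈-interval⁻ x∈)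
    ; (fsuc p) → subst (λ ℓ → ValidEntry k ℓ (lookup w p)) (sym (+-suc b (toℕ p))) (∈-validWords⁻ (suc b) w∈ p)
    }

  validWords-unique : ∀ b n → Unique (validWords k b n)
  validWords-unique b zero = [] ∷ []
  validWords-unique b (suc n) = Unique.cartesianProductWith⁺ _∷_ ∷-injective
    (interval-unique ((k ∸ b) ⊔ 1) k) (validWords-unique (suc b) n)

  choices : ∀ b → suc k ∸ ((k ∸ b) ⊔ 1) ≡ suc b ⊓ k
  choices b with b <? k
  ... | yes b<k = begin
    suc k ∸ ((k ∸ b) ⊔ 1) ≡⟨ cong (suc k ∸_) (m≥n⇒m⊔n≡m (m<n⇒0<n∸m b<k)) ⟩
    suc k ∸ (k ∸ b)       ≡⟨ +-∸-assoc 1 (m∸n≤m k b) ⟩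
    suc (k ∸ (k ∸ b))     ≡⟨ cong suc (m∸[m∸n]≡n (<⇒≤ b<k)) ⟩
    suc b                 ≡⟨ m≤n⇒m⊓n≡m b<k ⟨
    suc b ⊓ k             ∎
    where open ≡-Reasoning
  ... | no b≮k = begin
    suc k ∸ ((k ∸ b) ⊔ 1) ≡⟨ cong (λ d → suc k ∸ (d ⊔ 1)) (m≤n⇒m∸n≡0 (≮⇒≥ b≮k)) ⟩
    k                     ≡⟨ m≥n⇒m⊓n≡n (m≤n⇒m≤1+n (≮⇒≥ b≮k)) ⟨
    suc b ⊓ k             ∎
    where open ≡-Reasoning

  length-validWords-∷ : ∀ b n → length (validWords k b (suc n)) ≡ (suc b ⊓ k) * length (validWords k (suc b) n)
  length-validWords-∷ b n = begin
    length (validWords k b (suc n))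
      ≡⟨ length-cartesianProductWith _∷_ (interval ((k ∸ b) ⊔ 1) k) _ ⟩
    length (interval ((k ∸ b) ⊔ 1) k) * length (validWords k (suc b) n)
      ≡⟨ cong (_* length (validWords k (suc b) n)) (trans (length-interval ((k ∸ b) ⊔ 1) k) (choices b)) ⟩
    (suc b ⊓ k) * length (validWords k (suc b) n)
      ∎
    where open ≡-Reasoning

  length-validWords-∷ʳ : ∀ b n → length (validWords k b (suc n)) ≡ length (validWords k b n) * (suc (b + n) ⊓ k)
  length-validWords-∷ʳ b zero = begin
    length (validWords k b 1)   ≡⟨ length-validWords-∷ b 0 ⟩
    (suc b ⊓ k) * 1             ≡⟨ *-comm (suc b ⊓ k) 1 ⟩
    1 * (suc b ⊓ k)             ≡⟨ cong (λ m → 1 * (suc m ⊓ k)) (+-identityʳ b) ⟨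
    1 * (suc (b + 0) ⊓ k)       ∎
    where open ≡-Reasoning
  length-validWords-∷ʳ b (suc n) = begin
    length (validWords k b (suc (suc n)))
      ≡⟨ length-validWords-∷ b (suc n) ⟩
    (suc b ⊓ k) * length (validWords k (suc b) (suc n))
      ≡⟨ cong ((suc b ⊓ k) *_) (length-validWords-∷ʳ (suc b) n) ⟩
    (suc b ⊓ k) * (length (validWords k (suc b) n) * (suc (suc b + n) ⊓ k))
      ≡⟨ *-assoc (suc b ⊓ k) _ _ ⟨
    (suc b ⊓ k) * length (validWords k (suc b) n) * (suc (suc b + n) ⊓ k)
      ≡⟨ cong₂ _*_ (length-validWords-∷ b n) (cong (λ m → suc m ⊓ k) (+-suc b n)) ⟨
    length (validWords k b (suc n)) * (suc (b + suc n) ⊓ k)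
      ∎
    where open ≡-Reasoning

  length-validWords-≤ : ∀ n → n ≤ k → length (validWords k 0 n) ≡ n !
  length-validWords-≤ zero _ = refl
  length-validWords-≤ (suc n) n<k = begin
    length (validWords k 0 (suc n))           ≡⟨ length-validWords-∷ʳ 0 n ⟩
    length (validWords k 0 n) * (suc n ⊓ k)   ≡⟨ cong₂ _*_ (length-validWords-≤ n (<⇒≤ n<k)) (m≤n⇒m⊓n≡m n<k) ⟩
    n ! * suc n                               ≡⟨ *-comm (n !) (suc n) ⟩
    suc n !                                   ∎
    where open ≡-Reasoning

  length-validWords-≥ : ∀ n → k ≤ n → length (validWords k 0 n) ≡ k ! * k ^ (n ∸ k)
  length-validWords-≥ n k≤n with m≤n⇒m<n∨m≡n k≤n
  length-validWords-≥ (suc n) _ | inj₁ k<1+n = begin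
    length (validWords k 0 (suc n))           ≡⟨ length-validWords-∷ʳ 0 n ⟩
    length (validWords k 0 n) * (suc n ⊓ k)   ≡⟨ cong₂ _*_ (length-validWords-≥ n k≤n) (m≥n⇒m⊓n≡n (<⇒≤ k<1+n)) ⟩
    k ! * k ^ (n ∸ k) * k                     ≡⟨ *-assoc (k !) _ k ⟩
    k ! * (k ^ (n ∸ k) * k)                   ≡⟨ cong (k ! *_) (*-comm (k ^ (n ∸ k)) k) ⟩
    k ! * k ^ suc (n ∸ k)                     ≡⟨ cong (λ e → k ! * k ^ e) (+-∸-assoc 1 k≤n) ⟨
    k ! * k ^ (suc n ∸ k)                     ∎
    where
    open ≡-Reasoning
    k≤n : k ≤ n
    k≤n = ≤-pred k<1+n
  ... | inj₂ refl = begin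
    length (validWords k 0 k)  ≡⟨ length-validWords-≤ k ≤-refl ⟩
    k !                        ≡⟨ *-identityʳ (k !) ⟨
    k ! * k ^ 0                ≡⟨ cong (λ e → k ! * k ^ e) (n∸n≡0 k) ⟨
    k ! * k ^ (k ∸ k)          ∎
    where open ≡-Reasoning

hasCard-validWords : ∀ {k n} {P : Vec ℕ n → Set} → (∀ w → P w ⇔ ValidWord k w) →
  ∀ {N} → length (validWords k 0 n) ≡ N → HasCard P N
hasCard-validWords {k} {n} P⇔valid length≡N = validWords k 0 n , validWords-unique k 0 n ,
  (λ w → ⇔-sym (P⇔valid w) ⇔-∘ mk⇔ (∈-validWords⁻ k 0) (∈-validWords⁺ k 0)) , length≡N

-- Descent codes as counts

module _ {n : ℕ} (σ : Permutation′ n) where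

  -- σ on 0-based positions and values, with junk value 0 at positions m ≥ n.
  value : ℕ → ℕ
  value m with m <? n
  ... | yes m<n = toℕ (σ ⟨$⟩ʳ fromℕ< m<n)
  ... | no _ = 0

  value-fromℕ< : ∀ {m} (m<n : m < n) → value m ≡ toℕ (σ ⟨$⟩ʳ fromℕ< m<n)
  value-fromℕ< {m} m<n with m <? n
  ... | yes _ = refl
  ... | no m≮n = contradiction m<n m≮n

  value-toℕ : ∀ i → value (toℕ i) ≡ toℕ (σ ⟨$⟩ʳ i)
  value-toℕ i = trans (value-fromℕ< (toℕ<n i)) (cong (λ j → toℕ (σ ⟨$⟩ʳ j)) (fromℕ<-toℕ i (toℕ<n i)))

  value-< : ∀ {m} → m < n → value m < n
  value-< m<n = subst (_< n) (sym (value-fromℕ< m<n)) (toℕ<n _)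

  value-injective : ∀ {a b} → a < n → b < n → value a ≡ value b → a ≡ b
  value-injective {a} {b} a<n b<n eq = begin
    a                  ≡⟨ toℕ-fromℕ< a<n ⟨
    toℕ (fromℕ< a<n)   ≡⟨ cong toℕ (Injection.injective (↔⇒↣ σ) (toℕ-injective σa≡σb)) ⟩
    toℕ (fromℕ< b<n)   ≡⟨ toℕ-fromℕ< b<n ⟩
    b                  ∎
    where
    open ≡-Reasoning
    σa≡σb : toℕ (σ ⟨$⟩ʳ fromℕ< a<n) ≡ toℕ (σ ⟨$⟩ʳ fromℕ< b<n)
    σa≡σb = trans (sym (value-fromℕ< a<n)) (trans eq (value-fromℕ< b<n))

  ext-value : ∀ {m} → m < n → ext σ (+ suc m) ≡ + suc (value m)
  ext-value {m} m<n with m <? n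
  ... | yes _ = refl
  ... | no m≮n = contradiction m<n m≮n

  -- The position s + 1 places before p carries a value below r.  For p ≤ s that position
  -- is ≤ 0 in the paper's 1-based numbering, where σ is the identity, so it always counts.
  Below : ℕ → ℕ → Pred ℕ 0ℓ
  Below p r s = p ≤ s ⊎ (s < p × value (p ∸ suc s) < r)

  below? : ∀ p r → Decidable (Below p r)
  below? p r s = (p ≤? s) ⊎-dec ((s <? p) ×-dec (value (p ∸ suc s) <? r))

  lowerCount : ℕ → ℕ → ℕ → ℕ
  lowerCount k p r = length (filter (below? p r) (upTo k))

  code : ℕ → ℕ → ℕ
  code k p = suc (lowerCount k p (value p))

  ext-below⇔ : ∀ {p} → p < n →
    (λ s → ext σ (+ suc p ℤ.- + suc s) ℤ.< ext σ (+ suc p)) ≐ Below p (value p)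
  ext-below⇔ {p} p<n = to , from
    where
    earlier : ∀ {s} → s < p → + suc p ℤ.- + suc s ≡ + suc (p ∸ suc s)
    earlier {s} s<p = begin
      + suc p ℤ.- + suc s ≡⟨ [1+m]⊖[1+n]≡m⊖n p s ⟩
      p ⊖ s               ≡⟨ ⊖-≥ (<⇒≤ s<p) ⟩
      + (p ∸ s)           ≡⟨ cong +_ (+-∸-assoc 1 s<p) ⟩
      + suc (p ∸ suc s)   ∎
      where open ≡-Reasoning
    value-earlier : ∀ {s} → s < p → ext σ (+ suc p ℤ.- + suc s) ≡ + suc (value (p ∸ suc s))
    value-earlier {s} s<p = trans (cong (ext σ) (earlier s<p)) (ext-value (<-trans (∸-suc-< s<p) p<n))
    to : ∀ {s} → ext σ (+ suc p ℤ.- + suc s) ℤ.< ext σ (+ suc p) → Below p (value p) s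
    to {s} lt with p ≤? s
    ... | yes p≤s = inj₁ p≤s
    ... | no p≰s = inj₂ (s<p , s<s⁻¹ (drop‿+<+ (subst₂ ℤ._<_ (value-earlier s<p) (ext-value p<n) lt)))
      where s<p = ≰⇒> p≰s
    from : ∀ {s} → Below p (value p) s → ext σ (+ suc p ℤ.- + suc s) ℤ.< ext σ (+ suc p)
    from {s} (inj₁ p≤s) = subst₂ ℤ._<_ (cong (ext σ) (sym before-start)) (sym (ext-value p<n)) (nonpositive (s ∸ p))
      where
      before-start : + suc p ℤ.- + suc s ≡ ℤ.- (+ (s ∸ p))
      before-start = trans ([1+m]⊖[1+n]≡m⊖n p s) (⊖-≤ p≤s)
      nonpositive : ∀ m → ext σ (ℤ.- (+ m)) ℤ.< + suc (value p)
      nonpositive zero = +<+ (s≤s z≤n)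
      nonpositive (suc m) = -<+
    from {s} (inj₂ (s<p , lt)) = subst₂ ℤ._<_ (sym (value-earlier s<p)) (sym (ext-value p<n)) (+<+ (s≤s lt))

lookup-DC : ∀ k {n} (σ : Permutation′ n) i → lookup (DC (suc k) σ) i ≡ code σ k (toℕ i)
lookup-DC k σ i = begin
  lookup (DC (suc k) σ) i
    ≡⟨ lookup∘tabulate _ i ⟩
  suc (length (filter ext<? (map suc (upTo k))))
    ≡⟨ cong suc (length-filter-map ext<? suc (upTo k)) ⟩
  suc (length (filter (ext<? ∘ suc) (upTo k)))
    ≡⟨ cong (suc ∘ length) (filter-≐ (ext<? ∘ suc) (below? σ p (value σ p)) (ext-below⇔ σ (toℕ<n i)) (upTo k)) ⟩
  code σ k p
    ∎
  where
  open ≡-Reasoning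
  p : ℕ
  p = toℕ i
  ext<? : ∀ t → Dec (ext σ (+ suc p ℤ.- + t) ℤ.< ext σ (+ suc p))
  ext<? t = ext σ (+ suc p ℤ.- + t) ℤ.<? ext σ (+ suc p)

module _ {n : ℕ} (σ : Permutation′ n) (k : ℕ) where

  k∸p≤lowerCount : ∀ p r → k ∸ p ≤ lowerCount σ k p r
  k∸p≤lowerCount p r = begin
    k ∸ p                            ≡⟨ length-filter-≥-upTo p k ⟨
    length (filter (p ≤?_) (upTo k)) ≤⟨ length-filter-mono (p ≤?_) (below? σ p r) inj₁ (upTo k) ⟩
    lowerCount σ k p r               ∎
    where open ≤-Reasoning

  lowerCount≤k : ∀ p r → lowerCount σ k p r ≤ k
  lowerCount≤k p r = ≤-trans (length-filter (below? σ p r) (upTo k)) (≤-reflexive (length-upTo k))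

  code-valid : ∀ p → ValidEntry (suc k) p (code σ k p)
  code-valid p =
    ⊔-lub (≤-trans ([1+m]∸n≤1+[m∸n] k p) (s≤s (k∸p≤lowerCount p _))) (s≤s z≤n) , s≤s (lowerCount≤k p _)

  lowerCount-zero : lowerCount σ k n 0 ≡ k ∸ n
  lowerCount-zero = trans (cong length (filter-≐ (below? σ n 0) (n ≤?_) (to , inj₁) (upTo k))) (length-filter-≥-upTo n k)
    where
    to : ∀ {s} → Below σ n 0 s → n ≤ s
    to (inj₁ n≤s) = n≤s

  lowerCount-n : lowerCount σ k n n ≡ k
  lowerCount-n = trans (cong length (filter-all (below? σ n n) (All.universal below (upTo k)))) (length-upTo k)
    where
    below : ∀ s → Below σ n n s
    below s with n ≤? s
    ... | yes n≤s = inj₁ n≤s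
    ... | no n≰s = inj₂ (≰⇒> n≰s , value-< σ (∸-suc-< (≰⇒> n≰s)))

  lowerCount-suc : ∀ r → lowerCount σ k n (suc r) ≤ suc (lowerCount σ k n r)
  lowerCount-suc r = begin
    lowerCount σ k n (suc r)
      ≤⟨ length-filter-mono (below? σ n (suc r)) (below? σ n r ∪? hit?) split (upTo k) ⟩
    length (filter (below? σ n r ∪? hit?) (upTo k))
      ≤⟨ length-filter-∪ (below? σ n r) hit? (upTo k) ⟩
    lowerCount σ k n r + length (filter hit? (upTo k))
      ≤⟨ +-monoʳ-≤ (lowerCount σ k n r) (length-filter≤1 hit? hit-unique (Unique.upTo⁺ k)) ⟩
    lowerCount σ k n r + 1
      ≡⟨ +-comm _ 1 ⟩
    suc (lowerCount σ k n r)
      ∎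
    where
    open ≤-Reasoning
    Hit : Pred ℕ 0ℓ
    Hit s = s < n × value σ (n ∸ suc s) ≡ r
    hit? : Decidable Hit
    hit? s = (s <? n) ×-dec (value σ (n ∸ suc s) ≟ r)
    split : Below σ n (suc r) ⊆ Below σ n r ∪ Hit
    split (inj₁ n≤s) = inj₁ (inj₁ n≤s)
    split (inj₂ (s<n , v<1+r)) with m<1+n⇒m<n∨m≡n v<1+r
    ... | inj₁ v<r = inj₁ (inj₂ (s<n , v<r))
    ... | inj₂ v≡r = inj₂ (s<n , v≡r)
    hit-unique : ∀ {s s′} → Hit s → Hit s′ → s ≡ s′
    hit-unique (s<n , v≡r) (s′<n , v′≡r) = suc-injective (∸-cancelˡ-≡ s<n s′<n
      (value-injective σ (∸-suc-< s<n) (∸-suc-< s′<n) (trans v≡r (sym v′≡r))))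

  lowerCount-surjective : ∀ {c} → k ∸ n ≤ c → c ≤ k → ∃[ r ] r ≤ n × lowerCount σ k n r ≡ c
  lowerCount-surjective k∸n≤c c≤k = intermediate-value (lowerCount σ k n) lowerCount-suc n
    (≤-trans (≤-reflexive lowerCount-zero) k∸n≤c) (≤-trans c≤k (≤-reflexive (sym lowerCount-n)))

-- Appending a last value

punchIn-<⇔ : ∀ {n} (j : Fin (suc n)) {a b : Fin n} → toℕ a < toℕ b ⇔ toℕ (punchIn j a) < toℕ (punchIn j b)
punchIn-<⇔ j {a} {b} = mk⇔
  (λ a<b → ≰⇒> λ b′≤a′ → <⇒≱ a<b (punchIn-cancel-≤ j b a b′≤a′))
  (λ a′<b′ → ≰⇒> λ b≤a → <⇒≱ a′<b′ (punchIn-mono-≤ j b a b≤a))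

punchIn-<-pivot⇔ : ∀ {n} (j : Fin (suc n)) (a : Fin n) → toℕ a < toℕ j ⇔ toℕ (punchIn j a) < toℕ j
punchIn-<-pivot⇔ j a = mk⇔ (to j a) (from j a)
  where
  to : ∀ {n} (j : Fin (suc n)) (a : Fin n) → toℕ a < toℕ j → toℕ (punchIn j a) < toℕ j
  to (fsuc j) fzero a<j = a<j
  to (fsuc j) (fsuc a) a<j = s≤s (to j a (s<s⁻¹ a<j))
  from : ∀ {n} (j : Fin (suc n)) (a : Fin n) → toℕ (punchIn j a) < toℕ j → toℕ a < toℕ j
  from (fsuc j) fzero a′<j = a′<j
  from (fsuc j) (fsuc a) a′<j = s≤s (from j a (s<s⁻¹ a′<j))

toℕ-punchIn-fromℕ : ∀ {n} (a : Fin n) → toℕ (punchIn (fromℕ n) a) ≡ toℕ a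
toℕ-punchIn-fromℕ fzero = refl
toℕ-punchIn-fromℕ (fsuc a) = cong suc (toℕ-punchIn-fromℕ a)

insert-same : ∀ {m} (i j : Fin (suc m)) (π : Permutation′ m) → insert i j π ⟨$⟩ʳ i ≡ j
insert-same i j π with i Data.Fin.≟ i
... | yes _ = refl
... | no i≢i = contradiction refl i≢i

Below-cong : ∀ {n n′} (σ : Permutation′ n) (τ : Permutation′ n′) {p r r′} →
  (∀ {m} → m < p → value τ m < r′ ⇔ value σ m < r) → Below τ p r′ ≐ Below σ p r
Below-cong σ τ τ⇔σ = Below-map τ σ (Equivalence.to ∘ τ⇔σ) , Below-map σ τ (Equivalence.from ∘ τ⇔σ)
  where
  Below-map : ∀ {n n′} (σ : Permutation′ n) (τ : Permutation′ n′) {p r r′} →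
    (∀ {m} → m < p → value σ m < r → value τ m < r′) → Below σ p r ⊆ Below τ p r′
  Below-map σ τ f (inj₁ p≤s) = inj₁ p≤s
  Below-map σ τ f (inj₂ (s<p , lt)) = inj₂ (s<p , f (∸-suc-< s<p) lt)

insertLast : ∀ {n} → Permutation′ n → Fin (suc n) → Permutation′ (suc n)
insertLast {n} σ j = insert (fromℕ n) j σ

module _ {n : ℕ} (σ : Permutation′ n) (j : Fin (suc n)) where

  value-insertLast-last : value (insertLast σ j) n ≡ toℕ j
  value-insertLast-last = begin
    value (insertLast σ j) n               ≡⟨ cong (value (insertLast σ j)) (toℕ-fromℕ n) ⟨
    value (insertLast σ j) (toℕ (fromℕ n)) ≡⟨ value-toℕ (insertLast σ j) (fromℕ n) ⟩
    toℕ (insertLast σ j ⟨$⟩ʳ fromℕ n)      ≡⟨ cong toℕ (insert-same (fromℕ n) j σ) ⟩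
    toℕ j                                  ∎
    where open ≡-Reasoning

  value-insertLast-< : ∀ {m} (m<n : m < n) → value (insertLast σ j) m ≡ toℕ (punchIn j (σ ⟨$⟩ʳ fromℕ< m<n))
  value-insertLast-< {m} m<n = begin
    value (insertLast σ j) m                                 ≡⟨ cong (value (insertLast σ j)) m≡ ⟩
    value (insertLast σ j) (toℕ (punchIn (fromℕ n) i))       ≡⟨ value-toℕ (insertLast σ j) (punchIn (fromℕ n) i) ⟩
    toℕ (insertLast σ j ⟨$⟩ʳ punchIn (fromℕ n) i)            ≡⟨ cong toℕ (insert-punchIn (fromℕ n) j σ i) ⟩
    toℕ (punchIn j (σ ⟨$⟩ʳ i))                               ∎
    where
    open ≡-Reasoning
    i = fromℕ< m<n
    m≡ : m ≡ toℕ (punchIn (fromℕ n) i)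
    m≡ = sym (trans (toℕ-punchIn-fromℕ i) (toℕ-fromℕ< m<n))

  insertLast-<⇔ : ∀ {a b} → a < n → b < n →
    value (insertLast σ j) a < value (insertLast σ j) b ⇔ value σ a < value σ b
  insertLast-<⇔ a<n b<n
    rewrite value-insertLast-< a<n | value-insertLast-< b<n | value-fromℕ< σ a<n | value-fromℕ< σ b<n = ⇔-sym (punchIn-<⇔ j)

  insertLast-<-last⇔ : ∀ {a} → a < n → value (insertLast σ j) a < value (insertLast σ j) n ⇔ value σ a < toℕ j
  insertLast-<-last⇔ a<n
    rewrite value-insertLast-last | value-insertLast-< a<n | value-fromℕ< σ a<n = ⇔-sym (punchIn-<-pivot⇔ j _)

  code-insertLast-< : ∀ k {p} → p < n → code (insertLast σ j) k p ≡ code σ k p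
  code-insertLast-< k p<n = cong (suc ∘ length) (filter-≐ _ _
    (Below-cong σ (insertLast σ j) λ m<p → insertLast-<⇔ (<-trans m<p p<n) p<n) (upTo k))

  code-insertLast-last : ∀ k → code (insertLast σ j) k n ≡ suc (lowerCount σ k n (toℕ j))
  code-insertLast-last k = cong (suc ∘ length) (filter-≐ _ _
    (Below-cong σ (insertLast σ j) λ m<n → insertLast-<-last⇔ m<n) (upTo k))

insertLast-realises-last : ∀ k {n} (σ : Permutation′ n) {x} → ValidEntry (suc k) n x →
  ∃[ j ] code (insertLast σ j) k n ≡ x
insertLast-realises-last k {n} σ {x} (lower , upper) = j , (begin
  code (insertLast σ j) k n                  ≡⟨ code-insertLast-last σ j k ⟩
  suc (lowerCount σ k n (toℕ j))             ≡⟨ cong (suc ∘ lowerCount σ k n) (toℕ-fromℕ< _) ⟩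
  suc (lowerCount σ k n (proj₁ reachable))   ≡⟨ cong suc (proj₂ (proj₂ reachable)) ⟩
  suc (pred x)                               ≡⟨ suc-pred x {{>-nonZero (≤-trans (m≤n⊔m _ 1) lower)}} ⟩
  x                                          ∎)
  where
  open ≡-Reasoning
  k∸n≤pred-x : k ∸ n ≤ pred x
  k∸n≤pred-x = subst (_≤ pred x) (pred[m∸n]≡m∸[1+n] (suc k) n) (pred-mono-≤ (≤-trans (m≤m⊔n _ 1) lower))
  reachable : ∃[ r ] r ≤ n × lowerCount σ k n r ≡ pred x
  reachable = lowerCount-surjective σ k k∸n≤pred-x (pred-mono-≤ upper)
  j : Fin (suc n)
  j = fromℕ< (s≤s (proj₁ (proj₂ reachable)))

code-surjective : ∀ k n (f : ∀ p → p < n → ℕ) → (∀ p (p<n : p < n) → ValidEntry (suc k) p (f p p<n)) →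
  Σ[ σ ∈ Permutation′ n ] ∀ p (p<n : p < n) → code σ k p ≡ f p p<n
code-surjective k zero f _ = Permutation.id , λ _ ()
code-surjective k (suc n) f valid = insertLast σ j ,
  extend-agreement (code (insertLast σ j) k) f
    (λ p p<n → trans (code-insertLast-< σ j k p<n) (proj₂ restriction p p<n))
    (proj₂ last)
  where
  restriction : Σ[ σ ∈ Permutation′ n ] ∀ p (p<n : p < n) → code σ k p ≡ f p (m<n⇒m<1+n p<n)
  restriction = code-surjective k n (λ p p<n → f p (m<n⇒m<1+n p<n)) (λ p p<n → valid p (m<n⇒m<1+n p<n))
  σ : Permutation′ n
  σ = proj₁ restriction
  last : ∃[ j ] code (insertLast σ j) k n ≡ f n ≤-refl
  last = insertLast-realises-last k σ (valid n ≤-refl)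
  j : Fin (suc n)
  j = proj₁ last

-- Both directions use flip, as flip (flip σ) is definitionally σ by η for records.
isRCode⇔isDCode : ∀ k n {w} → IsRCode k n w ⇔ IsDCode k n w
isRCode⇔isDCode k n = mk⇔ (λ (σ , eq) → flip σ , eq) (λ (σ , eq) → flip σ , eq)

isDCode⇒validWord : ∀ k {n} (w : Vec ℕ n) → IsDCode (suc k) n w → ValidWord (suc k) w
isDCode⇒validWord k w (σ , refl) p = subst (ValidEntry (suc k) (toℕ p)) (sym (lookup-DC k σ p)) (code-valid σ k (toℕ p))

validWord⇒isDCode : ∀ k {n} (w : Vec ℕ n) → ValidWord (suc k) w → IsDCode (suc k) n w
validWord⇒isDCode k {n} w valid = σ , (begin
  DC (suc k) σ                      ≡⟨ tabulate∘lookup (DC (suc k) σ) ⟨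
  tabulate (lookup (DC (suc k) σ))  ≡⟨ tabulate-cong agrees ⟩
  tabulate (lookup w)               ≡⟨ tabulate∘lookup w ⟩
  w                                 ∎)
  where
  open ≡-Reasoning
  realised : Σ[ σ ∈ Permutation′ n ] ∀ p (p<n : p < n) → code σ k p ≡ lookup w (fromℕ< p<n)
  realised = code-surjective k n (λ p p<n → lookup w (fromℕ< p<n))
    (λ p p<n → subst (λ q → ValidEntry (suc k) q (lookup w (fromℕ< p<n))) (toℕ-fromℕ< p<n) (valid (fromℕ< p<n)))
  σ : Permutation′ n
  σ = proj₁ realised
  agrees : ∀ i → lookup (DC (suc k) σ) i ≡ lookup w i
  agrees i = begin
    lookup (DC (suc k) σ) i          ≡⟨ lookup-DC k σ i ⟩
    code σ k (toℕ i)                 ≡⟨ proj₂ realised (toℕ i) (toℕ<n i) ⟩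
    lookup w (fromℕ< (toℕ<n i))      ≡⟨ cong (lookup w) (fromℕ<-toℕ i (toℕ<n i)) ⟩
    lookup w i                       ∎

isDCode⇔validWord : ∀ k {n} (w : Vec ℕ n) → IsDCode (suc k) n w ⇔ ValidWord (suc k) w
isDCode⇔validWord k w = mk⇔ (isDCode⇒validWord k w) (validWord⇒isDCode k w)

mainTheorem1 : (k n : ℕ) → 1 ≤ k → 1 ≤ n →
    ((w : Vec ℕ n) → IsRCode k n w ⇔ ValidWord k w)
    × ((w : Vec ℕ n) → IsDCode k n w ⇔ ValidWord k w)
    × (n ≤ k → HasCard (IsDCode k n) (n !) × HasCard (IsRCode k n) (n !))
    × (k ≤ n → HasCard (IsDCode k n) (k ! * k ^ (n ∸ k)) × HasCard (IsRCode k n) (k ! * k ^ (n ∸ k)))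
mainTheorem1 (suc k) n _ _ =
  isRCode⇔validWord , isDCode⇔validWord k ,
  (λ n≤k → cards (length-validWords-≤ (suc k) n n≤k)) ,
  (λ k≤n → cards (length-validWords-≥ (suc k) n k≤n))
  where
  isRCode⇔validWord : (w : Vec ℕ n) → IsRCode (suc k) n w ⇔ ValidWord (suc k) w
  isRCode⇔validWord w = isDCode⇔validWord k w ⇔-∘ isRCode⇔isDCode (suc k) n
  cards : ∀ {N} → length (validWords (suc k) 0 n) ≡ N → HasCard (IsDCode (suc k) n) N × HasCard (IsRCode (suc k) n) N
  cards length≡N = hasCard-validWords (isDCode⇔validWord k) length≡N , hasCard-validWords isRCode⇔validWord length≡N
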